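{- For every positive integer $n$, $$\sum_{w\in\mathfrak{D}_n^+}t^{\mathsf{des}_D(w)}s^{\mathsf{asc}_D(w)}=\sum_{w\in\mathfrak{B}_{n,\mathfrak{D}}^+\setminus\mathfrak{D}_n^+}t^{\mathsf{des}_D(w)}s^{\mathsf{asc}_D(w)}=\frac12\sum_{w\in\mathfrak{B}_{n,\mathfrak{D}}^+}t^{\mathsf{des}_D(w)}s^{\mathsf{asc}_D(w)},$$ $$\sum_{w\in\mathfrak{D}_n^- }t^{\mathsf{des}_D(w)}s^{\mathsf{asc}_D(w)}=\sum_{w\in\mathfrak{B}_{n,\mathfrak{D}}^-\setminus\mathfrak{D}_n^- }t^{\mathsf{des}_D(w)}s^{\mathsf{asc}_D(w)}=\frac12\sum_{w\in\mathfrak{B}_{n,\mathfrak{D}}^- }t^{\mathsf{des}_D(w)}s^{\mathsf{asc}_D(w)}.$$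
   Context: $\mathfrak{B}_n$ is the group of signed permutations $w=w_1\cdots w_n$ of $\{\pm1,\dots,\pm n\}$ ($w(-i)=-w(i)$), and $\mathfrak{D}_n\subseteq\mathfrak{B}_n$ the subset with an even number of negative entries. For $w\in\mathfrak{B}_n$: $\mathsf{inv}_D(w)=|\{1\le i<j\le n:w_i>w_j\}|+|\{1\le i<j\le n:-w_i>w_j\}|$; $\mathsf{des}_D(w)=|\{i\in[n-1]:w_i>w_{i+1}\}|+\chi(w_1+w_2<0)$, where $\chi$ is the $0/1$ indicator; $\mathsf{asc}_D(w)=n-\mathsf{des}_D(w)$. $\mathfrak{D}_n^+=\{w\in\mathfrak{D}_n:\mathsf{inv}_D(w)\text{ even}\}$, $\mathfrak{D}_n^-=\mathfrak{D}_n\setminus\mathfrak{D}_n^+$, $\mathfrak{B}_{n,\mathfrak{D}}^+=\{w\in\mathfrak{B}_n:\mathsf{inv}_D(w)\text{ even}\}$, $\mathfrak{B}_{n,\mathfrak{D}}^-=\{w\in\mathfrak{B}_n:\mathsf{inv}_D(w)\text{ odd}\}$. -}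

module Defs where

open import Data.Bool using (Bool; true; false; _∧_; not; if_then_else_)
open import Data.Nat as ℕ using (ℕ; zero; suc; _+_; _*_; _∸_; _^_)
open import Data.Nat.DivMod using (_%_)
open import Data.Integer as ℤ using (ℤ; +_; -_; ∣_∣)
import Data.Integer.Properties as ℤP
import Data.Nat.Properties as ℕP
open import Data.List using (List; []; _∷_; map; concatMap; filterᵇ; length; applyUpTo; _++_)
open import Data.Nat.ListAction using (sum)
open import Relation.Nullary.Decidable using (⌊_⌋)

χ : Bool → ℕ
χ true  = 1
χ false = 0

letters : ℕ → List ℤ
letters n = applyUpTo (λ i → + suc i) n ++ applyUpTo (λ i → - (+ suc i)) n

words : List ℤ → ℕ → List (List ℤ)
words A zero    = [] ∷ []
words A (suc k) = concatMap (λ a → map (a ∷_) (words A k)) A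

notIn : ℕ → List ℕ → Bool
notIn x []       = true
notIn x (y ∷ ys) = not ⌊ x ℕ.≟ y ⌋ ∧ notIn x ys

distinct : List ℕ → Bool
distinct []       = true
distinct (x ∷ xs) = notIn x xs ∧ distinct xs

-- 𝔅_n : signed permutations w = w₁⋯wₙ of {±1,…,±n}, listed (without repetition)
-- as the words of length n over {±1,…,±n} whose absolute values are distinct,
-- i.e. |w₁|⋯|wₙ| is a permutation of [n].
B : ℕ → List (List ℤ)
B n = filterᵇ (λ w → distinct (map ∣_∣ w)) (words (letters n) n)

infix 4 _<b_
_<b_ : ℤ → ℤ → Bool
x <b y = ⌊ x ℤ.<? y ⌋

neg : List ℤ → ℕ
neg []       = 0
neg (x ∷ xs) = χ (x <b (+ 0)) + neg xs

invD : List ℤ → ℕ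
invD []       = 0
invD (x ∷ xs) = sum (map (λ y → χ (y <b x) + χ (y <b (- x))) xs) + invD xs

desA : List ℤ → ℕ
desA (x ∷ y ∷ ys) = χ (y <b x) + desA (y ∷ ys)
desA _            = 0

-- des_D(w) = #{i ∈ [n-1] : w_i > w_{i+1}} + χ(w₁ + w₂ < 0)
-- (the χ-term is only present when n ≥ 2, since w₂ must exist)
desD : List ℤ → ℕ
desD (x ∷ y ∷ ys) = desA (x ∷ y ∷ ys) + χ ((x ℤ.+ y) <b (+ 0))
desD _            = 0

ascD : List ℤ → ℕ
ascD w = length w ∸ desD w

isEven : ℕ → Bool
isEven m = (m % 2) ℕ.≡ᵇ 0

inD : List ℤ → Bool
inD w = isEven (neg w)

invEven : List ℤ → Bool
invEven w = isEven (invD w)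

Bplus Bminus : ℕ → List (List ℤ)
Bplus n  = filterᵇ invEven (B n)
Bminus n = filterᵇ (λ w → not (invEven w)) (B n)

Dplus Dminus : ℕ → List (List ℤ)
Dplus n  = filterᵇ inD (Bplus n)
Dminus n = filterᵇ inD (Bminus n)

BplusNotD BminusNotD : ℕ → List (List ℤ)
BplusNotD n  = filterᵇ (λ w → not (inD w)) (Bplus n)
BminusNotD n = filterᵇ (λ w → not (inD w)) (Bminus n)

desAscSum : ℕ → ℕ → List (List ℤ) → ℕ
desAscSum t s S = sum (map (λ w → t ^ desD w * s ^ ascD w) S)

-- Reversing the sign of the first letter is an involution on 𝔅_n. It preserves inv_D
-- (the two inversion counts contributed by w₁ trade places), des_D (the tests w₁ > w₂
-- and w₁ + w₂ < 0 trade places) and asc_D, and it changes the parity of the number of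
-- negative entries. Hence within each class of fixed inv_D-parity it matches 𝔇_n with
-- its complement, weight for weight.
module Submission where

open import Defs
open import Data.Nat using (ℕ; _≤_; _*_)
open import Data.Product using (_×_)
open import Relation.Binary.PropositionalEquality using (_≡_)

import Algebra.Properties.CommutativeSemigroup as CommSemigroupProperties
open import Data.Bool using (Bool; true; false; not; if_then_else_)
open import Data.Bool.Properties using (not-involutive)
open import Data.Integer as ℤ using (ℤ; -_; +[1+_]; -[1+_]; 0ℤ)
import Data.Integer.Properties as ℤP
open import Data.List using (List; []; _∷_; map; concatMap; filterᵇ; length; applyUpTo; _++_)
open import Data.List.Properties using (map-++; map-cong; map-∘)
open import Data.Nat as ℕ using (zero; suc; _+_; _∸_; _^_)
import Data.Nat.Properties as ℕP
open import Data.Nat.ListAction using (sum)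
open import Data.Nat.ListAction.Properties using (sum-++)
open import Data.Product using (_,_)
open import Function using (_∘_; _⇔_; mk⇔)
open import Relation.Binary.PropositionalEquality using (refl; sym; trans; cong; cong₂; subst; subst₂; module ≡-Reasoning)
open import Relation.Nullary.Decidable using (does; isYes; isYes≗does; does-⇔)

open CommSemigroupProperties ℕP.+-commutativeSemigroup using (x∙yz≈y∙xz; xy∙z≈zy∙x)

module _ {a} {A : Set a} where

  mask : (A → Bool) → (A → ℕ) → A → ℕ
  mask p h x = if p x then h x else 0

  mask-comm : ∀ p q h (x : A) → mask p (mask q h) x ≡ mask q (mask p h) x
  mask-comm p q h x with p x | q x
  ... | true  | _     = refl
  ... | false | true  = refl
  ... | false | false = refl

  mask-cong : ∀ p {h h′ : A → ℕ} → (∀ x → h x ≡ h′ x) → ∀ x → mask p h x ≡ mask p h′ x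
  mask-cong p h≗h′ x = cong (if p x then_else 0) (h≗h′ x)

  sum-map-++ : ∀ (h : A → ℕ) xs ys → sum (map h (xs ++ ys)) ≡ sum (map h xs) + sum (map h ys)
  sum-map-++ h xs ys = trans (cong sum (map-++ h xs ys)) (sum-++ (map h xs) (map h ys))

  sum-map-filterᵇ : ∀ (h : A → ℕ) p xs → sum (map h (filterᵇ p xs)) ≡ sum (map (mask p h) xs)
  sum-map-filterᵇ h p []       = refl
  sum-map-filterᵇ h p (x ∷ xs) with p x
  ... | true  = cong (h x +_) (sum-map-filterᵇ h p xs)
  ... | false = sum-map-filterᵇ h p xs

  sum-map-filterᵇ-partition : ∀ (h : A → ℕ) p xs →
    sum (map h (filterᵇ p xs)) + sum (map h (filterᵇ (not ∘ p) xs)) ≡ sum (map h xs)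
  sum-map-filterᵇ-partition h p []       = refl
  sum-map-filterᵇ-partition h p (x ∷ xs) with p x
  ... | true  = trans (ℕP.+-assoc (h x) _ _) (cong (h x +_) (sum-map-filterᵇ-partition h p xs))
  ... | false = trans (x∙yz≈y∙xz (sum (map h (filterᵇ p xs))) (h x) _)
                      (cong (h x +_) (sum-map-filterᵇ-partition h p xs))

  sum-map-concatMap : ∀ {b} {B : Set b} (h : A → ℕ) (f : B → List A) xs →
    sum (map h (concatMap f xs)) ≡ sum (map (λ x → sum (map h (f x))) xs)
  sum-map-concatMap h f []       = refl
  sum-map-concatMap h f (x ∷ xs) =
    trans (sum-map-++ h (f x) (concatMap f xs)) (cong (_ +_) (sum-map-concatMap h f xs))

  sum-map-applyUpTo-cong : ∀ (F G : A → ℕ) {f g : ℕ → A} → (∀ i → F (f i) ≡ G (g i)) →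
    ∀ n → sum (map F (applyUpTo f n)) ≡ sum (map G (applyUpTo g n))
  sum-map-applyUpTo-cong F G eq zero    = refl
  sum-map-applyUpTo-cong F G eq (suc n) = cong₂ _+_ (eq 0) (sum-map-applyUpTo-cong F G (eq ∘ suc) n)

sum-map-words-suc : ∀ (h : List ℤ → ℕ) A k →
  sum (map h (words A (suc k))) ≡ sum (map (λ x → sum (map (h ∘ (x ∷_)) (words A k))) A)
sum-map-words-suc h A k =
  trans (sum-map-concatMap h (λ x → map (x ∷_) (words A k)) A)
        (cong sum (map-cong (λ x → cong sum (sym (map-∘ (words A k)))) A))

sum-map-letters-swap : ∀ (F G : ℤ → ℕ) →
  (∀ i → F +[1+ i ] ≡ G -[1+ i ]) → (∀ i → F -[1+ i ] ≡ G +[1+ i ]) →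
  ∀ n → sum (map F (letters n)) ≡ sum (map G (letters n))
sum-map-letters-swap F G F⁺≡G⁻ F⁻≡G⁺ n = begin
  sum (map F (positives ++ negatives))            ≡⟨ sum-map-++ F positives negatives ⟩
  sum (map F positives) + sum (map F negatives)   ≡⟨ cong₂ _+_ (sum-map-applyUpTo-cong F G F⁺≡G⁻ n)
                                                                 (sum-map-applyUpTo-cong F G F⁻≡G⁺ n) ⟩
  sum (map G negatives) + sum (map G positives)   ≡⟨ ℕP.+-comm (sum (map G negatives)) _ ⟩
  sum (map G positives) + sum (map G negatives)   ≡⟨ sum-map-++ G positives negatives ⟨
  sum (map G (positives ++ negatives))            ∎
  where
  open ≡-Reasoning
  positives negatives : List ℤ
  positives = applyUpTo (λ i → +[1+ i ]) n
  negatives = applyUpTo (λ i → -[1+ i ]) n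

sum-map-words-swap-head-sign : ∀ (H₁ H₂ : List ℤ → ℕ) →
  (∀ i v → H₁ (+[1+ i ] ∷ v) ≡ H₂ (-[1+ i ] ∷ v)) →
  (∀ i v → H₁ (-[1+ i ] ∷ v) ≡ H₂ (+[1+ i ] ∷ v)) →
  ∀ n k → sum (map H₁ (words (letters n) (suc k))) ≡ sum (map H₂ (words (letters n) (suc k)))
sum-map-words-swap-head-sign H₁ H₂ H₁⁺≡H₂⁻ H₁⁻≡H₂⁺ n k = begin
  sum (map H₁ (words (letters n) (suc k)))  ≡⟨ sum-map-words-suc H₁ (letters n) k ⟩
  sum (map (summed H₁) (letters n))         ≡⟨ sum-map-letters-swap (summed H₁) (summed H₂)
                                                 (λ i → cong sum (map-cong (H₁⁺≡H₂⁻ i) W))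
                                                 (λ i → cong sum (map-cong (H₁⁻≡H₂⁺ i) W)) n ⟩
  sum (map (summed H₂) (letters n))         ≡⟨ sum-map-words-suc H₂ (letters n) k ⟨
  sum (map H₂ (words (letters n) (suc k)))  ∎
  where
  open ≡-Reasoning
  W : List (List ℤ)
  W = words (letters n) k
  summed : (List ℤ → ℕ) → ℤ → ℕ
  summed H x = sum (map (H ∘ (x ∷_)) W)

HeadSignInvariant : ∀ {b} {B : Set b} → (List ℤ → B) → Set b
HeadSignInvariant f = ∀ i v → f (+[1+ i ] ∷ v) ≡ f (-[1+ i ] ∷ v)

HeadSignReversing : (List ℤ → Bool) → Set
HeadSignReversing p = ∀ i v → p (-[1+ i ] ∷ v) ≡ not (p (+[1+ i ] ∷ v))

mask-headSignInvariant : ∀ p h → HeadSignInvariant p → HeadSignInvariant h →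
  HeadSignInvariant (mask p h)
mask-headSignInvariant p h p-inv h-inv i v = cong₂ (if_then_else 0) (p-inv i v) (h-inv i v)

sum-map-words-mask-balanced : ∀ p (f : List ℤ → ℕ) → HeadSignReversing p → HeadSignInvariant f →
  ∀ n k → sum (map (mask p f) (words (letters n) (suc k)))
        ≡ sum (map (mask (not ∘ p) f) (words (letters n) (suc k)))
sum-map-words-mask-balanced p f p-rev f-inv =
  sum-map-words-swap-head-sign (mask p f) (mask (not ∘ p) f) positive-head negative-head
  where
  positive-head : ∀ i v → mask p f (+[1+ i ] ∷ v) ≡ mask (not ∘ p) f (-[1+ i ] ∷ v)
  positive-head i v rewrite p-rev i v | not-involutive (p (+[1+ i ] ∷ v)) | f-inv i v = refl
  negative-head : ∀ i v → mask p f (-[1+ i ] ∷ v) ≡ mask (not ∘ p) f (+[1+ i ] ∷ v)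
  negative-head i v rewrite p-rev i v | f-inv i v = refl

x+z<0⇔z<-x : ∀ x z → (x ℤ.+ z ℤ.< 0ℤ) ⇔ (z ℤ.< - x)
x+z<0⇔z<-x x z = mk⇔ to from
  where
  -x+[x+z]≡z : - x ℤ.+ (x ℤ.+ z) ≡ z
  -x+[x+z]≡z = trans (sym (ℤP.+-assoc (- x) x z))
                     (trans (cong (ℤ._+ z) (ℤP.+-inverseˡ x)) (ℤP.+-identityˡ z))
  to : x ℤ.+ z ℤ.< 0ℤ → z ℤ.< - x
  to x+z<0 = subst₂ ℤ._<_ -x+[x+z]≡z (ℤP.+-identityʳ (- x)) (ℤP.+-monoʳ-< (- x) x+z<0)
  from : z ℤ.< - x → x ℤ.+ z ℤ.< 0ℤ
  from z<-x = subst (x ℤ.+ z ℤ.<_) (ℤP.+-inverseʳ x) (ℤP.+-monoʳ-< x z<-x)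

x+z<b0≡z<b-x : ∀ x z → (x ℤ.+ z <b 0ℤ) ≡ (z <b - x)
x+z<b0≡z<b-x x z = begin
  isYes (x ℤ.+ z ℤ.<? 0ℤ)  ≡⟨ isYes≗does _ ⟩
  does (x ℤ.+ z ℤ.<? 0ℤ)   ≡⟨ does-⇔ (x+z<0⇔z<-x x z) (x ℤ.+ z ℤ.<? 0ℤ) (z ℤ.<? - x) ⟩
  does (z ℤ.<? - x)        ≡⟨ isYes≗does _ ⟨
  isYes (z ℤ.<? - x)       ∎
  where open ≡-Reasoning

isEven-suc : ∀ m → isEven (suc m) ≡ not (isEven m)
isEven-suc zero          = refl
isEven-suc (suc zero)    = refl
isEven-suc (suc (suc m)) = isEven-suc m

invD-headSignInvariant : HeadSignInvariant invD
invD-headSignInvariant i v =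
  cong (_+ invD v) (cong sum (map-cong (λ y → ℕP.+-comm (χ (y <b +[1+ i ])) _) v))

desD-headSignInvariant : HeadSignInvariant desD
desD-headSignInvariant i []       = refl
desD-headSignInvariant i (z ∷ v) = begin
  below⁺ + d + χ (+[1+ i ] ℤ.+ z <b 0ℤ)  ≡⟨ cong (λ b → below⁺ + d + χ b) (x+z<b0≡z<b-x +[1+ i ] z) ⟩
  below⁺ + d + below⁻                   ≡⟨ xy∙z≈zy∙x below⁺ d below⁻ ⟩
  below⁻ + d + below⁺                   ≡⟨ cong (λ b → below⁻ + d + χ b) (x+z<b0≡z<b-x -[1+ i ] z) ⟨
  below⁻ + d + χ (-[1+ i ] ℤ.+ z <b 0ℤ)  ∎
  where
  open ≡-Reasoning
  below⁺ below⁻ d : ℕ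
  below⁺ = χ (z <b +[1+ i ])
  below⁻ = χ (z <b -[1+ i ])
  d = desA (z ∷ v)

inD-headSignReversing : HeadSignReversing inD
inD-headSignReversing i v = isEven-suc (neg v)

invEven-headSignInvariant : HeadSignInvariant invEven
invEven-headSignInvariant i v = cong isEven (invD-headSignInvariant i v)

module _ (t s : ℕ) where

  weight : List ℤ → ℕ
  weight w = t ^ desD w * s ^ ascD w

  weight-headSignInvariant : HeadSignInvariant weight
  weight-headSignInvariant i v =
    cong (λ d → t ^ d * s ^ (suc (length v) ∸ d)) (desD-headSignInvariant i v)

  module _ (e : List ℤ → Bool) (e-inv : HeadSignInvariant e) where

    desAscSum-inD-balanced : ∀ n → 1 ≤ n →
      desAscSum t s (filterᵇ inD (filterᵇ e (B n)))
        ≡ desAscSum t s (filterᵇ (not ∘ inD) (filterᵇ e (B n)))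
    desAscSum-inD-balanced (suc k) _ = begin
      desAscSum t s (filterᵇ inD (filterᵇ e (B n)))         ≡⟨ as-masked-sum inD ⟩
      sum (map (mask inD admissible) W)                    ≡⟨ sum-map-words-mask-balanced inD admissible
                                                                inD-headSignReversing admissible-inv n k ⟩
      sum (map (mask (not ∘ inD) admissible) W)            ≡⟨ as-masked-sum (not ∘ inD) ⟨
      desAscSum t s (filterᵇ (not ∘ inD) (filterᵇ e (B n))) ∎
      where
      open ≡-Reasoning
      n : ℕ
      n = suc k
      W : List (List ℤ)
      W = words (letters n) n
      distinctAbs : List ℤ → Bool
      distinctAbs w = distinct (map ℤ.∣_∣ w)
      admissible : List ℤ → ℕ
      admissible = mask distinctAbs (mask e weight)
      admissible-inv : HeadSignInvariant admissible
      admissible-inv = mask-headSignInvariant distinctAbs (mask e weight) (λ _ _ → refl)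
                         (mask-headSignInvariant e weight e-inv weight-headSignInvariant)
      as-masked-sum : ∀ q → desAscSum t s (filterᵇ q (filterᵇ e (B n))) ≡ sum (map (mask q admissible) W)
      as-masked-sum q = begin
        desAscSum t s (filterᵇ q (filterᵇ e (B n)))
          ≡⟨ sum-map-filterᵇ weight q (filterᵇ e (B n)) ⟩
        sum (map (mask q weight) (filterᵇ e (B n)))
          ≡⟨ sum-map-filterᵇ (mask q weight) e (B n) ⟩
        sum (map (mask e (mask q weight)) (B n))
          ≡⟨ sum-map-filterᵇ (mask e (mask q weight)) distinctAbs W ⟩
        sum (map (mask distinctAbs (mask e (mask q weight))) W)
          ≡⟨ cong sum (map-cong (λ w → trans (mask-cong distinctAbs (mask-comm e q weight) w)
                                             (mask-comm distinctAbs q (mask e weight) w)) W) ⟩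
        sum (map (mask q admissible) W) ∎

    desAscSum-halves : ∀ n → 1 ≤ n →
      (desAscSum t s (filterᵇ inD (filterᵇ e (B n)))
         ≡ desAscSum t s (filterᵇ (not ∘ inD) (filterᵇ e (B n))))
      × (2 * desAscSum t s (filterᵇ (not ∘ inD) (filterᵇ e (B n))) ≡ desAscSum t s (filterᵇ e (B n)))
    desAscSum-halves n 1≤n = balanced , (begin
      2 * N⁻   ≡⟨ cong (N⁻ +_) (ℕP.+-identityʳ N⁻) ⟩
      N⁻ + N⁻  ≡⟨ cong (_+ N⁻) balanced ⟨
      N⁺ + N⁻  ≡⟨ sum-map-filterᵇ-partition weight inD (filterᵇ e (B n)) ⟩
      desAscSum t s (filterᵇ e (B n)) ∎)
      where
      open ≡-Reasoning
      N⁺ N⁻ : ℕ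
      N⁺ = desAscSum t s (filterᵇ inD (filterᵇ e (B n)))
      N⁻ = desAscSum t s (filterᵇ (not ∘ inD) (filterᵇ e (B n)))
      balanced : N⁺ ≡ N⁻
      balanced = desAscSum-inD-balanced n 1≤n

lemma32 : (n : ℕ) → 1 ≤ n → (t s : ℕ) →
    ((desAscSum t s (Dplus n) ≡ desAscSum t s (BplusNotD n))
      × (2 * desAscSum t s (BplusNotD n) ≡ desAscSum t s (Bplus n)))
    × ((desAscSum t s (Dminus n) ≡ desAscSum t s (BminusNotD n))
      × (2 * desAscSum t s (BminusNotD n) ≡ desAscSum t s (Bminus n)))
lemma32 n 1≤n t s =
    desAscSum-halves t s invEven invEven-headSignInvariant n 1≤n
  , desAscSum-halves t s (not ∘ invEven) (λ i v → cong not (invEven-headSignInvariant i v)) n 1≤n
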